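{- Calling algorithm naive-fvs on $(G,k,\emptyset)$ solves the feedback vertex set instance $(G,k)$. That is, it returns a set $V_-\subseteq V(G)$ with $|V_-|\le k$ such that $G-V_-$ is a forest if such a set exists, and returns ``no'' otherwise. Algorithm naive-fvs on an extended instance $(G,k,F)$, where $F\subseteq V(G)$ induces a forest; degrees are taken in the current graph $G$: 0. If $k<0$, return ``no''. If $V(G)=\emptyset$, return $\emptyset$. 1. If some vertex $v$ has degree less than two, return naive-fvs$(G-\{v\},k,F\setminus\{v\})$. 2. If some vertex $v\in V(G)\setminus F$ has two neighbors in the same component of $G[F]$, let $X\leftarrow$ naive-fvs$(G-\{v\},k-1,F)$. Return ``no'' if $X$ is ``no'', and $X\cup\{v\}$ otherwise. 3. Pick $v\in V(G)\setminus F$ of maximum degree. 4. If $d(v)=2$: - set $X\leftarrow\emptyset$; - while $G$ contains a cycle $C$, take any vertex $x$ of $C$ not in $F$, add $x$ to $X$, and delete $x$ from $G$; - return $X$ if $|X|\le k$, and ``no'' otherwise. 5. Let $X\leftarrow$ naive-fvs$(G-\{v\},k-1,F)$. If $X$ is not ``no'', return $X\cup\{v\}$. 6. Return naive-fvs$(G,k,F\cup\{v\})$.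
   Context: All graphs are finite, simple and undirected. A feedback vertex set of $G$ is a set of vertices whose deletion leaves a forest. In an extended instance $(G,k,F)$, the solution may only use vertices of $V(G)\setminus F$. -}

module Defs where

open import Data.Nat as ℕ using (ℕ; suc; _<_; _≤_)
open import Data.Integer as ℤ using (ℤ; +_; _-_)
open import Data.Bool using (Bool; true)
open import Data.Fin using (Fin)
open import Data.Fin.Subset as Sub
  using (Subset; _∈_; _∉_; _∩_; _∪_; ⁅_⁆; ∣_∣; ∁; Nonempty; Empty)
open import Data.Vec using (tabulate)
open import Data.List using (List; []; _∷_; _++_; length)
import Data.List.Membership.Propositional as LM
open import Data.List.Relation.Unary.All using (All)
open import Data.List.Relation.Unary.Unique.Propositional using (Unique)
open import Data.List.Relation.Unary.Linked using (Linked)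
open import Data.Maybe using (Maybe; just; nothing)
open import Data.Product using (Σ; ∃; _×_)
open import Data.Empty as E using ()
open import Relation.Binary.PropositionalEquality using (_≡_; _≢_)
open import Relation.Nullary using (¬_)

-- A finite simple graph on vertex set Fin n, given by a Boolean adjacency
-- function (symmetry and irreflexivity are assumed in the statement).
-- Every graph occurring during the algorithm is an induced subgraph
-- G[S] of the input graph, so the "current graph" is represented by a
-- vertex subset S; deleting v is  S - v.
module FVS {n : ℕ} (adj : Fin n → Fin n → Bool) where

  Adj : Fin n → Fin n → Set
  Adj u w = adj u w ≡ true

  nbrs : Fin n → Subset n
  nbrs v = tabulate (adj v)

  deg : Subset n → Fin n → ℕ
  deg S v = ∣ nbrs v ∩ S ∣

  -- cs = v0 ∷ v1 ∷ … ∷ v(m-1) is a cycle of G[S]: m ≥ 3 distinct vertices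
  -- of S, consecutive ones adjacent, and v(m-1) adjacent to v0.
  IsCycle : Subset n → List (Fin n) → Set
  IsCycle S [] = E.⊥
  IsCycle S (v ∷ vs) =
    2 ≤ length vs × Unique (v ∷ vs) × All (_∈ S) (v ∷ vs)
      × Linked Adj ((v ∷ vs) ++ (v ∷ []))

  Forest : Subset n → Set
  Forest S = ∀ cs → ¬ IsCycle S cs

  data Reach (A : Subset n) : Fin n → Fin n → Set where
    here : ∀ {u} → u ∈ A → Reach A u u
    step : ∀ {u w x} → u ∈ A → Adj u w → Reach A w x → Reach A u x

  NoLowDeg : Subset n → Set
  NoLowDeg S = ∀ v → v ∈ S → 2 ≤ deg S v

  Step2 : Subset n → Subset n → Fin n → Set
  Step2 S F v = v ∈ S × v ∉ F ×
    Σ (Fin n) λ u → Σ (Fin n) λ w →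
      u ≢ w × Adj v u × Adj v w × u ∈ F × w ∈ F × Reach F u w

  MaxDeg : Subset n → Subset n → Fin n → Set
  MaxDeg S F v = v ∈ S × v ∉ F ×
    (∀ u → u ∈ S → u ∉ F → deg S u ≤ deg S v)

  -- Step 4 while-loop: Loop F S X X' means that starting with current
  -- graph G[S] and accumulated set X, some execution of the loop ends
  -- with accumulated set X'.
  data Loop (F : Subset n) : Subset n → Subset n → Subset n → Set where
    done : ∀ {S X} → Forest S → Loop F S X X
    next : ∀ {S X X' cs x} → IsCycle S cs → x LM.∈ cs → x ∉ F →
           Loop F (S Sub.- x) (X ∪ ⁅ x ⁆) X' → Loop F S X X'

  -- Run S k F r : some execution of naive-fvs on the extended instance
  -- (G[S], k, F) returns r  (nothing = "no", just X = the set X).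
  -- All nondeterministic choices of the algorithm are covered; the steps
  -- are tried in order, encoded by the guards.
  data Run : Subset n → ℤ → Subset n → Maybe (Subset n) → Set where
    step0-neg   : ∀ {S k F} → k ℤ.< + 0 → Run S k F nothing
    step0-empty : ∀ {S k F} → + 0 ℤ.≤ k → Empty S → Run S k F (just Sub.⊥)
    step1 : ∀ {S k F r} v → + 0 ℤ.≤ k → Nonempty S →
            v ∈ S → deg S v < 2 →
            Run (S Sub.- v) k (F Sub.- v) r → Run S k F r
    step2-no : ∀ {S k F} v → + 0 ℤ.≤ k → Nonempty S → NoLowDeg S →
            Step2 S F v →
            Run (S Sub.- v) (k - + 1) F nothing → Run S k F nothing
    step2-yes : ∀ {S k F X} v → + 0 ℤ.≤ k → Nonempty S → NoLowDeg S →
            Step2 S F v →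
            Run (S Sub.- v) (k - + 1) F (just X) → Run S k F (just (X ∪ ⁅ v ⁆))
    step4-yes : ∀ {S k F X} v → + 0 ℤ.≤ k → Nonempty S → NoLowDeg S →
            (∀ u → ¬ Step2 S F u) → MaxDeg S F v → deg S v ≡ 2 →
            Loop F S Sub.⊥ X → + ∣ X ∣ ℤ.≤ k → Run S k F (just X)
    step4-no : ∀ {S k F X} v → + 0 ℤ.≤ k → Nonempty S → NoLowDeg S →
            (∀ u → ¬ Step2 S F u) → MaxDeg S F v → deg S v ≡ 2 →
            Loop F S Sub.⊥ X → ¬ (+ ∣ X ∣ ℤ.≤ k) → Run S k F nothing
    step5 : ∀ {S k F X} v → + 0 ℤ.≤ k → Nonempty S → NoLowDeg S →
            (∀ u → ¬ Step2 S F u) → MaxDeg S F v → deg S v ≢ 2 →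
            Run (S Sub.- v) (k - + 1) F (just X) → Run S k F (just (X ∪ ⁅ v ⁆))
    step6 : ∀ {S k F r} v → + 0 ℤ.≤ k → Nonempty S → NoLowDeg S →
            (∀ u → ¬ Step2 S F u) → MaxDeg S F v → deg S v ≢ 2 →
            Run (S Sub.- v) (k - + 1) F nothing →
            Run S k (F ∪ ⁅ v ⁆) r → Run S k F r

  Solves : ℕ → Maybe (Subset n) → Set
  Solves k (just Y) = ∣ Y ∣ ≤ k × Forest (∁ Y)
  Solves k nothing = ¬ (Σ (Subset n) λ Y → ∣ Y ∣ ≤ k × Forest (∁ Y))

-- naive-fvs is analysed through an invariant of its runs on extended instances (G[S], k, F),
-- where F ⊆ S induces a forest: a returned set X has |X| ≤ k and G[S] - X is a forest, while
-- the answer no means that G[S] has no feedback vertex set of size at most k disjoint from F.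
-- Most steps preserve it directly: a vertex of degree below two lies on no cycle, a solution
-- avoiding the vertex v of step 2 would keep the cycle formed by v and a path in F, and in
-- steps 2 and 6 every solution either contains v or avoids it.  The crux is step 4, where all
-- vertices outside F have degree at most two.  There, deleting a vertex x of a cycle costs
-- every F-avoiding feedback vertex set Y a vertex: if x ∉ Y and no y ∈ Y could be dropped
-- once x is gone, each y ∈ Y would lie on a cycle of G[S] - x meeting Y only in y, and
-- splicing these cycles into the cycle through x would give a cycle avoiding Y.  Hence the
-- greedy loop removes at most |Y| vertices.  A run always exists because every recursive
-- call decreases |S| + |S ∖ F|.

module Submission where

open import Defs
open import Data.Nat as ℕ using (ℕ; zero; suc; _+_; _≤_; _<_; z≤n; s≤s)
import Data.Nat.Properties as ℕₚ
open import Data.Integer as ℤ using (ℤ; +_; -[1+_]; +≤+; -<+)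
import Data.Integer.Properties as ℤₚ
open import Data.Bool using (Bool; true; false) renaming (_≟_ to _≟ᵇ_)
open import Data.Fin using (Fin; zero; suc; _≟_)
open import Data.Fin.Properties using (any?)
open import Data.Fin.Subset
  using (Subset; _∈_; _∉_; _∩_; _∪_; ⁅_⁆; ∣_∣; Nonempty; Empty; _─_; _-_; _⊆_; _⊂_; ⊤; ⊥; inside)
open import Data.Fin.Subset.Properties
  using ( _∈?_; nonempty?; ∈⊤; ∉⊥; x∈⁅x⁆; x∈⁅y⁆⇒x≡y; ∣⁅x⁆∣≡1; ∣p∣≤n; ∣p∣≤∣x∷p∣; ∣⊥∣≡0
        ; p⊆q⇒∣p∣≤∣q∣; p⊂q⇒∣p∣<∣q∣; x∈p∩q⁺; x∈p∩q⁻; x∈p∪q⁺; x∈p∪q⁻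
        ; x∈p∧x∉q⇒x∈p─q; p─q⊆p; x∈p∧x≢y⇒x∈p-y; x∈p⇒∣p-x∣<∣p∣; x∈∁p⇒x∉p; x∉p⇒x∈∁p)
open import Data.Vec using ([]; _∷_; here; there; tabulate)
import Data.Vec.Properties as Vecₚ
open import Data.List using (List; []; _∷_; _++_; [_]; length; allFin; filter)
import Data.List.Properties as Listₚ
open import Data.List.Membership.Propositional using (find) renaming (_∈_ to _∈ₗ_)
open import Data.List.Membership.Propositional.Properties using (∈-∃++; ∈-allFin; ∈-filter⁺)
open import Data.List.Relation.Unary.All as All using (All; []; _∷_)
import Data.List.Relation.Unary.All.Properties as Allₚ
open import Data.List.Relation.Unary.Any using (here; there)
open import Data.List.Relation.Unary.AllPairs using ([]; _∷_)
open import Data.List.Relation.Unary.Unique.Propositional using (Unique)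
import Data.List.Relation.Unary.Unique.Propositional.Properties as Uniqueₚ
open import Data.List.Relation.Unary.Linked using (Linked; [-]; _∷_)
open import Data.List.Extrema.Nat using (argmax; argmax-all; f[xs]≤f[argmax])
open import Data.Maybe using (Maybe; just; nothing)
open import Data.Product using (Σ; ∃; _×_; _,_; proj₁; proj₂; map₂)
open import Data.Sum using (_⊎_; inj₁; inj₂)
open import Data.Empty using (⊥-elim)
open import Function using (_∘_; id)
open import Relation.Binary.PropositionalEquality using (_≡_; _≢_; refl; sym; trans; cong; subst)
open import Relation.Nullary using (¬_; Dec; yes; no; ¬?)
open import Relation.Nullary.Decidable using (_×-dec_; decidable-stable)

private variable n : ℕ

x∈p─q⇒x∉q : ∀ {x : Fin n} (p q : Subset n) → x ∈ p ─ q → x ∉ q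
x∈p─q⇒x∉q {x = zero}  (s ∷ p) (inside ∷ q) () here
x∈p─q⇒x∉q {x = suc x} (s ∷ p) (t ∷ q) (there x∈) (there x∈q) = x∈p─q⇒x∉q p q x∈ x∈q

x∈p─q⁻ : ∀ {x : Fin n} {p q : Subset n} → x ∈ p ─ q → x ∈ p × x ∉ q
x∈p─q⁻ {p = p} {q} x∈ = p─q⊆p p q x∈ , x∈p─q⇒x∉q p q x∈

x∈p-y⁻ : ∀ {x y : Fin n} {p : Subset n} → x ∈ p - y → x ∈ p × x ≢ y
x∈p-y⁻ {y = y} x∈ with x∈p─q⁻ x∈
... | x∈p , x∉y = x∈p , λ { refl → x∉y (x∈⁅x⁆ y) }

x∈p∪⁅y⁆⁻ : ∀ {x y : Fin n} (p : Subset n) → x ∈ p ∪ ⁅ y ⁆ → x ∈ p ⊎ x ≡ y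
x∈p∪⁅y⁆⁻ {y = y} p x∈ with x∈p∪q⁻ p ⁅ y ⁆ x∈
... | inj₁ x∈p = inj₁ x∈p
... | inj₂ x∈y = inj₂ (x∈⁅y⁆⇒x≡y y x∈y)

p-x⊆p : ∀ {p : Subset n} {x} → p - x ⊆ p
p-x⊆p {p = p} {x} = p─q⊆p p ⁅ x ⁆

─-mono : ∀ {p p′ q q′ : Subset n} → p ⊆ p′ → q′ ⊆ q → p ─ q ⊆ p′ ─ q′
─-mono p⊆ q⊆ x∈ with x∈p─q⁻ x∈
... | x∈p , x∉q = x∈p∧x∉q⇒x∈p─q (p⊆ x∈p) (x∉q ∘ q⊆)

p-x─q-x⊆p─q : ∀ {p q : Subset n} {x} → (p - x) ─ (q - x) ⊆ p ─ q
p-x─q-x⊆p─q y∈ with x∈p─q⁻ y∈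
... | y∈p-x , y∉q-x = let y∈p , y≢x = x∈p-y⁻ y∈p-x in
  x∈p∧x∉q⇒x∈p─q y∈p λ y∈q → y∉q-x (x∈p∧x≢y⇒x∈p-y y∈q y≢x)

p⊆q⇒p⊆q-x : ∀ {p q : Subset n} {x} → p ⊆ q → x ∉ p → p ⊆ q - x
p⊆q⇒p⊆q-x p⊆q x∉p y∈p = x∈p∧x≢y⇒x∈p-y (p⊆q y∈p) λ { refl → x∉p y∈p }

p⊆q⇒p∪⁅x⁆⊆q : ∀ {p q : Subset n} {x} → p ⊆ q → x ∈ q → p ∪ ⁅ x ⁆ ⊆ q
p⊆q⇒p∪⁅x⁆⊆q {p = p} p⊆q x∈q y∈ with x∈p∪⁅y⁆⁻ p y∈
... | inj₁ y∈p  = p⊆q y∈p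
... | inj₂ refl = x∈q

p∪⁅x⁆-x⊆p : ∀ {p : Subset n} {x} → (p ∪ ⁅ x ⁆) - x ⊆ p
p∪⁅x⁆-x⊆p {p = p} y∈ with x∈p-y⁻ y∈
... | y∈p∪x , y≢x with x∈p∪⁅y⁆⁻ p y∈p∪x
...   | inj₁ y∈p = y∈p
...   | inj₂ y≡x = ⊥-elim (y≢x y≡x)

∣p∪q∣≤∣p∣+∣q∣ : (p q : Subset n) → ∣ p ∪ q ∣ ≤ ∣ p ∣ + ∣ q ∣
∣p∪q∣≤∣p∣+∣q∣ [] [] = z≤n
∣p∪q∣≤∣p∣+∣q∣ (true ∷ p) (t ∷ q) =
  s≤s (ℕₚ.≤-trans (∣p∪q∣≤∣p∣+∣q∣ p q) (ℕₚ.+-monoʳ-≤ ∣ p ∣ (∣p∣≤∣x∷p∣ t q)))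
∣p∪q∣≤∣p∣+∣q∣ (false ∷ p) (true ∷ q) rewrite ℕₚ.+-suc ∣ p ∣ ∣ q ∣ = s≤s (∣p∪q∣≤∣p∣+∣q∣ p q)
∣p∪q∣≤∣p∣+∣q∣ (false ∷ p) (false ∷ q) = ∣p∪q∣≤∣p∣+∣q∣ p q

∣p∪⁅x⁆∣≤1+∣p∣ : (p : Subset n) (x : Fin n) → ∣ p ∪ ⁅ x ⁆ ∣ ≤ suc ∣ p ∣
∣p∪⁅x⁆∣≤1+∣p∣ p x = ℕₚ.≤-trans (∣p∪q∣≤∣p∣+∣q∣ p ⁅ x ⁆)
  (ℕₚ.≤-reflexive (trans (cong (λ m → ∣ p ∣ + m) (∣⁅x⁆∣≡1 x)) (ℕₚ.+-comm ∣ p ∣ 1)))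

all-∈-delete : ∀ {x : Fin n} {xs p} → All (x ≢_) xs → All (_∈ p) xs → All (_∈ p - x) xs
all-∈-delete x∉ xs⊆p = All.zipWith (λ (x≢y , y∈p) → x∈p∧x≢y⇒x∈p-y y∈p (x≢y ∘ sym)) (x∉ , xs⊆p)

length≤∣p∣ : ∀ {xs : List (Fin n)} (p : Subset n) → Unique xs → All (_∈ p) xs → length xs ≤ ∣ p ∣
length≤∣p∣ p [] [] = z≤n
length≤∣p∣ p (x∉xs ∷ xs!) (x∈p ∷ xs⊆p) = ℕₚ.≤-trans
  (s≤s (length≤∣p∣ _ xs! (all-∈-delete x∉xs xs⊆p)))
  (x∈p⇒∣p-x∣<∣p∣ x∈p)

module _ {a ℓ} {A : Set a} {R : A → A → Set ℓ} where

  linked-∷ʳ : ∀ {z y : A} xs → Linked R (xs ++ [ z ]) → R z y → Linked R ((xs ++ [ z ]) ++ [ y ])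
  linked-∷ʳ []           [-]        zy = zy ∷ [-]
  linked-∷ʳ (x ∷ [])     (xz ∷ l)   zy = xz ∷ linked-∷ʳ [] l zy
  linked-∷ʳ (x ∷ x′ ∷ xs) (xx′ ∷ l) zy = xx′ ∷ linked-∷ʳ (x′ ∷ xs) l zy

unique-++⁻ʳ : ∀ {a} {A : Set a} (xs : List A) {ys} → Unique (xs ++ ys) → Unique ys
unique-++⁻ʳ []       u       = u
unique-++⁻ʳ (x ∷ xs) (_ ∷ u) = unique-++⁻ʳ xs u

m≤k-1⇒1+m≤k : ∀ {m k} → + m ℤ.≤ k ℤ.- + 1 → + suc m ℤ.≤ k
m≤k-1⇒1+m≤k {k = + suc _} (+≤+ m≤j) = +≤+ (s≤s m≤j)
m≤k-1⇒1+m≤k {k = + zero}  ()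
m≤k-1⇒1+m≤k {k = -[1+ _ ]} ()

1+m≤k⇒m≤k-1 : ∀ {m k} → + suc m ℤ.≤ k → + m ℤ.≤ k ℤ.- + 1
1+m≤k⇒m≤k-1 {k = + suc _} (+≤+ (s≤s m≤j)) = +≤+ m≤j

module NaiveFVS {n : ℕ} (adj : Fin n → Fin n → Bool)
  (adj-sym : ∀ u v → adj u v ≡ adj v u) (adj-irrefl : ∀ v → adj v v ≡ false) where

  open FVS adj
  open import Data.List.Membership.DecPropositional (_≟_ {n}) using () renaming (_∈?_ to _∈ₗ?_)

  private variable
    A B F K S T X X′ Y : Subset n
    a b c u v w x y z : Fin n
    xs cs : List (Fin n)
    k : ℤ
    r : Maybe (Subset n)

  Adj-sym : Adj u v → Adj v u
  Adj-sym {u} {v} uv = trans (adj-sym v u) uv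

  Adj-irrefl : ¬ Adj v v
  Adj-irrefl {v} vv with trans (sym vv) (adj-irrefl v)
  ... | ()

  Adj? : ∀ u v → Dec (Adj u v)
  Adj? u v = adj u v ≟ᵇ true

  ∈nbrs∩⁺ : Adj v u → u ∈ S → u ∈ nbrs v ∩ S
  ∈nbrs∩⁺ {v} vu u∈S =
    x∈p∩q⁺ (Vecₚ.lookup⇒[]= _ (tabulate (adj v)) (trans (Vecₚ.lookup∘tabulate (adj v) _) vu) , u∈S)

  ∈nbrs∩⁻ : u ∈ nbrs v ∩ S → Adj v u × u ∈ S
  ∈nbrs∩⁻ {u} {v} {S} u∈ with x∈p∩q⁻ (nbrs v) S u∈
  ... | u∈nbrs , u∈S = trans (sym (Vecₚ.lookup∘tabulate (adj v) u)) (Vecₚ.[]=⇒lookup u∈nbrs) , u∈S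

  -- Walks, paths and cycles

  reach-source : Reach A u w → u ∈ A
  reach-source (here u∈A)     = u∈A
  reach-source (step u∈A _ _) = u∈A

  reach-target : Reach A u w → w ∈ A
  reach-target (here w∈A)   = w∈A
  reach-target (step _ _ r) = reach-target r

  reach-mono : A ⊆ B → Reach A u w → Reach B u w
  reach-mono A⊆B (here u∈A)      = here (A⊆B u∈A)
  reach-mono A⊆B (step u∈A uv r) = step (A⊆B u∈A) uv (reach-mono A⊆B r)

  reach-trans : Reach A u v → Reach A v w → Reach A u w
  reach-trans (here _)        r′ = r′
  reach-trans (step u∈A uv r) r′ = step u∈A uv (reach-trans r r′)

  reach-snoc : Reach A u v → Adj v w → w ∈ A → Reach A u w
  reach-snoc r vw w∈A = reach-trans r (step (reach-target r) vw (here w∈A))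

  reach-sym : Reach A u w → Reach A w u
  reach-sym (here u∈A)      = here u∈A
  reach-sym (step u∈A uv r) = reach-snoc (reach-sym r) (Adj-sym uv) u∈A

  data Path (A : Subset n) : Fin n → Fin n → List (Fin n) → Set where
    end  : u ∈ A → Path A u u [ u ]
    cons : u ∈ A → Adj u v → Path A v w xs → Path A u w (u ∷ xs)

  path⇒reach : Path A u w xs → Reach A u w
  path⇒reach (end u∈A)       = here u∈A
  path⇒reach (cons u∈A uv P) = step u∈A uv (path⇒reach P)

  path-vertices : Path A u w xs → All (_∈ A) xs
  path-vertices (end u∈A)      = u∈A ∷ []
  path-vertices (cons u∈A _ P) = u∈A ∷ path-vertices P

  path-restrict : Path A u w xs → All (_∈ B) xs → Path B u w xs
  path-restrict (end _)       (u∈B ∷ [])    = end u∈B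
  path-restrict (cons _ uv P) (u∈B ∷ xs⊆B) = cons u∈B uv (path-restrict P xs⊆B)

  path-linked : Path A u w xs → Adj w z → Linked Adj (xs ++ [ z ])
  path-linked (end _)                    wz = wz ∷ [-]
  path-linked (cons _ uv (end w∈A))      wz = uv ∷ path-linked (end w∈A) wz
  path-linked (cons _ uv P@(cons _ _ _)) wz = uv ∷ path-linked P wz

  path-suffix : ∀ as {bs} → Path A u w (as ++ v ∷ bs) → Path A v w (v ∷ bs)
  path-suffix []            (end u∈A)       = end u∈A
  path-suffix []            (cons u∈A uv P) = cons u∈A uv P
  path-suffix (_ ∷ [])      (cons _ _ P)    = path-suffix [] P
  path-suffix (_ ∷ a ∷ as)  (cons _ _ P)    = path-suffix (a ∷ as) P

  reach-member : Path A u w xs → v ∈ₗ xs → Reach A u v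
  reach-member (end u∈A)       (here refl) = here u∈A
  reach-member (cons u∈A _ _)  (here refl) = here u∈A
  reach-member (cons u∈A uv P) (there v∈)  = step u∈A uv (reach-member P v∈)

  -- Cutting out the part of the walk before the last visit of its start makes it a path.
  reach⇒path : Reach A u w → ∃ λ xs → Path A u w xs × Unique xs
  reach⇒path (here u∈A) = _ , end u∈A , [] ∷ []
  reach⇒path {u = u} (step u∈A uv r) with reach⇒path r
  ... | xs , P , xs! with u ∈ₗ? xs
  ...   | no u∉xs = u ∷ xs , cons u∈A uv P , Allₚ.¬Any⇒All¬ xs u∉xs ∷ xs!
  ...   | yes u∈xs with ∈-∃++ u∈xs
  ...     | as , bs , refl = u ∷ bs , path-suffix as P , unique-++⁻ʳ as xs!

  reach-leave : Reach A u w → u ≢ w → ∃ λ z → Adj u z × Reach (A - u) z w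
  reach-leave r u≢w with reach⇒path r
  ... | _ , end _ , _ = ⊥-elim (u≢w refl)
  ... | _ , cons _ uz P , (u∉ ∷ _) =
    _ , uz , path⇒reach (path-restrict P (all-∈-delete u∉ (path-vertices P)))

  reach? : ∀ A u w → Dec (Reach A u w)
  reach? A u w = go (suc ∣ A ∣) A u w (ℕₚ.n<1+n _)
    where
    go : ∀ t A u w → ∣ A ∣ < t → Dec (Reach A u w)
    go zero _ _ _ ()
    go (suc t) A u w (s≤s ∣A∣≤t) with u ∈? A | u ≟ w
    ... | no u∉A | _        = no (u∉A ∘ reach-source)
    ... | yes u∈A | yes refl = yes (here u∈A)
    ... | yes u∈A | no u≢w
      with any? (λ z → Adj? u z ×-dec go t (A - u) z w (ℕₚ.<-≤-trans (x∈p⇒∣p-x∣<∣p∣ u∈A) ∣A∣≤t))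
    ...   | yes (z , uz , z⇝w) = yes (step u∈A uz (reach-mono p-x⊆p z⇝w))
    ...   | no none            = no λ r → none (reach-leave r u≢w)

  cycle-vertices : IsCycle S cs → All (_∈ S) cs
  cycle-vertices {cs = _ ∷ _} (_ , _ , cs⊆S , _) = cs⊆S

  cycle-restrict : IsCycle S cs → All (_∈ T) cs → IsCycle T cs
  cycle-restrict {cs = _ ∷ _} (long , cs! , _ , closed) cs⊆T = long , cs! , cs⊆T , closed

  cycle-mono : S ⊆ T → IsCycle S cs → IsCycle T cs
  cycle-mono S⊆T C = cycle-restrict C (All.map S⊆T (cycle-vertices C))

  forest-anti : T ⊆ S → Forest S → Forest T
  forest-anti T⊆S forest cs C = forest cs (cycle-mono T⊆S C)

  empty⇒forest : Empty S → Forest S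
  empty⇒forest ∅ []      ()
  empty⇒forest ∅ (v ∷ _) C = ∅ (v , All.head (cycle-vertices C))

  rotate-one : IsCycle S (a ∷ b ∷ cs) → IsCycle S (b ∷ cs ++ [ a ])
  rotate-one {cs = cs} (long , (a∉ ∷ b∷cs!) , (a∈S ∷ b∷cs⊆S) , (ab ∷ closed)) =
    subst (2 ≤_) (sym (trans (Listₚ.length-++ cs) (ℕₚ.+-comm (length cs) 1))) long ,
    Uniqueₚ.++⁺ b∷cs! ([] ∷ []) (λ { (a∈ , here refl) → Allₚ.All¬⇒¬Any a∉ a∈ }) ,
    Allₚ.++⁺ b∷cs⊆S (a∈S ∷ []) ,
    linked-∷ʳ (_ ∷ cs) closed ab

  rotate : ∀ as {bs} → IsCycle S (as ++ v ∷ bs) → IsCycle S (v ∷ bs ++ as)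
  rotate {S = S} {v = v} [] {bs} C = subst (λ l → IsCycle S (v ∷ l)) (sym (Listₚ.++-identityʳ bs)) C
  rotate (a ∷ []) C = rotate-one C
  rotate {S = S} {v = v} (a ∷ a′ ∷ as) {bs} C =
    subst (λ l → IsCycle S (v ∷ l)) (Listₚ.++-assoc bs [ a ] (a′ ∷ as))
      (rotate (a′ ∷ as)
        (subst (λ l → IsCycle S (a′ ∷ l)) (Listₚ.++-assoc as (v ∷ bs) [ a ]) (rotate-one C)))

  CycleThrough : Subset n → Fin n → Set
  CycleThrough S v = v ∈ S × Σ (Fin n) λ u → Σ (Fin n) λ w →
    u ≢ w × Adj v u × Adj v w × Reach (S - v) u w

  through⇒cycle : CycleThrough S v → ∃ (IsCycle S)
  through⇒cycle {S} {v} (v∈S , u , w , u≢w , vu , vw , u⇝w) with reach⇒path u⇝w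
  ... | _ , end _ , _ = ⊥-elim (u≢w refl)
  ... | u ∷ xs , P@(cons _ _ P′) , xs! =
    v ∷ u ∷ xs , long P′ , All.map (λ x∈ v≡x → x∈p-y⁻ x∈ .proj₂ (sym v≡x)) S-v ∷ xs! ,
    v∈S ∷ All.map (λ x∈ → x∈p-y⁻ x∈ .proj₁) S-v , vu ∷ path-linked P (Adj-sym vw)
    where
    S-v = path-vertices P
    long : Path (S - v) a w cs → 2 ≤ length (u ∷ cs)
    long (end _)      = s≤s (s≤s z≤n)
    long (cons _ _ _) = s≤s (s≤s z≤n)

  through⇒¬forest : CycleThrough S v → ¬ Forest S
  through⇒¬forest through forest with through⇒cycle through
  ... | cs , C = forest cs C

  reach-along : All (_∈ A) (u ∷ xs) → Linked Adj (u ∷ xs ++ [ z ]) →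
                ∃ λ w → Reach A u w × Adj w z × w ∈ₗ u ∷ xs
  reach-along {xs = []}    (u∈A ∷ []) (uz ∷ [-]) = _ , here u∈A , uz , here refl
  reach-along {xs = _ ∷ _} (u∈A ∷ xs⊆A) (uy ∷ walk) with reach-along xs⊆A walk
  ... | w , y⇝w , wz , w∈ = w , step u∈A uy y⇝w , wz , there w∈

  cycle-head⇒through : IsCycle S (v ∷ cs) → CycleThrough S v
  cycle-head⇒through {cs = []}    (() , _)
  cycle-head⇒through {cs = _ ∷ []} (s≤s () , _)
  cycle-head⇒through {S} {v} {u ∷ y ∷ ys} (_ , (v∉ ∷ u∉ ∷ _) , (v∈S ∷ cs⊆S) , (vu ∷ uy ∷ walk))
    with all-∈-delete v∉ cs⊆S
  ... | u∈ ∷ ys⊆ with reach-along ys⊆ walk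
  ...   | w , y⇝w , wv , w∈ =
    v∈S , u , w , (λ { refl → Allₚ.All¬⇒¬Any u∉ w∈ }) , vu , Adj-sym wv , step u∈ uy y⇝w

  cycle⇒through : IsCycle S cs → v ∈ₗ cs → CycleThrough S v
  cycle⇒through C v∈ with ∈-∃++ v∈
  ... | as , bs , refl = cycle-head⇒through (rotate as C)

  forest-deleted⇒through : Forest (S - v) → IsCycle S cs → CycleThrough S v
  forest-deleted⇒through {v = v} {cs = cs} forest C with v ∈ₗ? cs
  ... | yes v∈ = cycle⇒through C v∈
  ... | no v∉ = ⊥-elim (forest cs (cycle-restrict C
    (all-∈-delete (Allₚ.¬Any⇒All¬ cs v∉) (cycle-vertices C))))

  -- Degrees and acyclicity

  deg-mono : S ⊆ T → deg S v ≤ deg T v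
  deg-mono S⊆T = p⊆q⇒∣p∣≤∣q∣ λ u∈ → let vu , u∈S = ∈nbrs∩⁻ u∈ in ∈nbrs∩⁺ vu (S⊆T u∈S)

  2≤deg : u ≢ w → Adj v u → Adj v w → u ∈ S → w ∈ S → 2 ≤ deg S v
  2≤deg {v = v} {S} u≢w vu vw u∈S w∈S =
    length≤∣p∣ (nbrs v ∩ S) ((u≢w ∷ []) ∷ [] ∷ []) (∈nbrs∩⁺ vu u∈S ∷ ∈nbrs∩⁺ vw w∈S ∷ [])

  through⇒2≤deg : CycleThrough S v → 2 ≤ deg S v
  through⇒2≤deg (_ , _ , _ , u≢w , vu , vw , u⇝w) =
    2≤deg u≢w vu vw (p-x⊆p (reach-source u⇝w)) (p-x⊆p (reach-target u⇝w))

  another-neighbour : 2 ≤ deg S v → ∀ a → ∃ λ u → Adj v u × u ∈ S × u ≢ a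
  another-neighbour {S} {v} 2≤d a with any? (λ u → Adj? v u ×-dec u ∈? S ×-dec ¬? (u ≟ a))
  ... | yes found = found
  ... | no none = ⊥-elim (ℕₚ.<⇒≱ 2≤d (ℕₚ.≤-trans (p⊆q⇒∣p∣≤∣q∣ nbrs⊆a) (ℕₚ.≤-reflexive (∣⁅x⁆∣≡1 a))))
    where
    nbrs⊆a : nbrs v ∩ S ⊆ ⁅ a ⁆
    nbrs⊆a {u} u∈ with u ≟ a
    ... | yes refl = x∈⁅x⁆ a
    ... | no u≢a = let vu , u∈S = ∈nbrs∩⁻ u∈ in ⊥-elim (none (u , vu , u∈S , u≢a))

  deg≤2⇒neighbour∈ : deg S v ≤ 2 → a ≢ b → Adj v a → Adj v b → a ∈ S → b ∈ S →
                     Adj v c → c ∈ S → c ≡ a ⊎ c ≡ b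
  deg≤2⇒neighbour∈ {S} {v} {a} {b} {c} d≤2 a≢b va vb a∈S b∈S vc c∈S with c ≟ a | c ≟ b
  ... | yes c≡a | _        = inj₁ c≡a
  ... | no _    | yes c≡b  = inj₂ c≡b
  ... | no c≢a  | no c≢b   = ⊥-elim (ℕₚ.<⇒≱ (length≤∣p∣ (nbrs v ∩ S)
        ((a≢b ∷ (c≢a ∘ sym) ∷ []) ∷ ((c≢b ∘ sym) ∷ []) ∷ [] ∷ [])
        (∈nbrs∩⁺ va a∈S ∷ ∈nbrs∩⁺ vb b∈S ∷ ∈nbrs∩⁺ vc c∈S ∷ [])) d≤2)

  low-degree-forest : deg S v < 2 → Forest (S - v) → Forest S
  low-degree-forest d<2 forest cs C = ℕₚ.<⇒≱ d<2 (through⇒2≤deg (forest-deleted⇒through forest C))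

  no-low-degree : ¬ (∃ λ v → v ∈ S × deg S v < 2) → NoLowDeg S
  no-low-degree none v v∈S = ℕₚ.≮⇒≥ λ low → none (v , v∈S , low)

  -- Walk backwards from v, always to a vertex not yet visited; when the walk gets
  -- stuck at e, some neighbour of e other than its successor closes a cycle through e.
  mindeg⇒through : NoLowDeg S → v ∈ S → ∃ (CycleThrough S)
  mindeg⇒through {S} {v} δ v∈S = extend n (end v∈S) ([] ∷ []) (ℕₚ.n<1+n n)
    where
    stuck⇒through : ∀ {e xs} → Path S e v xs → Unique xs → (∀ {u} → Adj e u → u ∈ S → u ∈ₗ xs) →
                    CycleThrough S e
    stuck⇒through {e} (end e∈S) _ visited with another-neighbour (δ e e∈S) e
    ... | u , eu , u∈S , u≢e with visited eu u∈S
    ...   | here u≡e = ⊥-elim (u≢e u≡e)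
    stuck⇒through {e} (cons {v = s} e∈S es P) (e∉ ∷ _) visited with another-neighbour (δ e e∈S) s
    ... | u , eu , u∈S , u≢s with visited eu u∈S
    ...   | here refl = ⊥-elim (Adj-irrefl eu)
    ...   | there u∈ = e∈S , s , u , u≢s ∘ sym , es , eu ,
                       reach-member (path-restrict P (all-∈-delete e∉ (path-vertices P))) u∈

    extend : ∀ t {e xs} → Path S e v xs → Unique xs → n < length xs + t → ∃ (CycleThrough S)
    extend zero P xs! n< = ⊥-elim (ℕₚ.<⇒≱ (subst (n <_) (ℕₚ.+-identityʳ _) n<)
      (ℕₚ.≤-trans (length≤∣p∣ S xs! (path-vertices P)) (∣p∣≤n S)))
    extend (suc t) {e} {xs} P xs! n< with any? (λ u → Adj? e u ×-dec u ∈? S ×-dec ¬? (u ∈ₗ? xs))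
    ... | yes (u , eu , u∈S , u∉xs) =
      extend t (cons u∈S (Adj-sym eu) P) (Allₚ.¬Any⇒All¬ xs u∉xs ∷ xs!)
        (subst (n <_) (ℕₚ.+-suc (length xs) t) n<)
    ... | no none = e , stuck⇒through P xs! λ {u} eu u∈S →
                      decidable-stable (u ∈ₗ? xs) λ u∉xs → none (u , eu , u∈S , u∉xs)

  forest-or-cycle : ∀ S → Forest S ⊎ ∃ (IsCycle S)
  forest-or-cycle S = go (suc ∣ S ∣) S (ℕₚ.n<1+n _)
    where
    go : ∀ t S → ∣ S ∣ < t → Forest S ⊎ ∃ (IsCycle S)
    go zero _ ()
    go (suc t) S (s≤s ∣S∣≤t) with any? (λ v → v ∈? S ×-dec deg S v ℕ.<? 2)
    ... | yes (v , v∈S , low) with go t (S - v) (ℕₚ.<-≤-trans (x∈p⇒∣p-x∣<∣p∣ v∈S) ∣S∣≤t)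
    ...   | inj₁ forest     = inj₁ (low-degree-forest low forest)
    ...   | inj₂ (cs , C)   = inj₂ (cs , cycle-mono p-x⊆p C)
    go (suc t) S _ | no none with nonempty? S
    ...   | yes (v , v∈S) = inj₂ (through⇒cycle (mindeg⇒through (no-low-degree none) v∈S .proj₂))
    ...   | no ∅          = inj₁ (empty⇒forest ∅)

  forest? : ∀ S → Dec (Forest S)
  forest? S with forest-or-cycle S
  ... | inj₁ forest  = yes forest
  ... | inj₂ (cs , C) = no λ forest → forest cs C

  ¬forest⇒cycle : ¬ Forest S → ∃ (IsCycle S)
  ¬forest⇒cycle {S} ¬forest with forest-or-cycle S
  ... | inj₁ forest = ⊥-elim (¬forest forest)
  ... | inj₂ cycle  = cycle

  cycle-leaves-forest : Forest F → IsCycle S cs → ∃ λ x → x ∈ₗ cs × x ∉ F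
  cycle-leaves-forest {F} {cs = cs} forest C with All.all? (_∈? F) cs
  ... | yes cs⊆F = ⊥-elim (forest cs (cycle-restrict C cs⊆F))
  ... | no cs⊈F  = find (Allₚ.¬All⇒Any¬ (_∈? F) cs cs⊈F)

  step2? : ∀ S F → Dec (∃ (Step2 S F))
  step2? S F = any? λ v → v ∈? S ×-dec ¬? (v ∈? F) ×-dec any? λ u → any? λ w →
    ¬? (u ≟ w) ×-dec Adj? v u ×-dec Adj? v w ×-dec u ∈? F ×-dec w ∈? F ×-dec reach? F u w

  -- The exchange argument behind step 4

  FeedbackSet : Subset n → Subset n → Subset n → Set
  FeedbackSet S F Y = (∀ {x} → x ∈ Y → x ∉ F) × Forest (S ─ Y)

  -- with c = d this says that every neighbour of y in B lies in K
  Bridged : Subset n → Subset n → Fin n → Set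
  Bridged B K y = ∀ {c d} → Adj y c → Adj y d → c ∈ B → d ∈ B → Reach K c d

  -- Follow the walk, replacing each step through a vertex outside K by its bridge.
  reach-through-bridges : A ⊆ B → (∀ {y} → y ∈ A → y ∉ K → Bridged B K y) →
                          Reach A u w → u ∈ K → w ∈ K → Reach K u w
  reach-through-bridges {A} {B} {K} {u} {w} A⊆B bridged u⇝w u∈K w∈K = continue (here u∈K) u⇝w
    where
    continue : Reach K u v → Reach A v w → Reach K u w
    cross    : Reach K u v → v ∈ A → Adj v c → Reach A c w → Reach K u w

    continue u⇝v (here _)          = u⇝v
    continue u⇝v (step v∈A vc c⇝w) = cross u⇝v v∈A vc c⇝w

    cross u⇝v _ vc (here _) = reach-snoc u⇝v vc w∈K
    cross u⇝v v∈A vc (step c∈A ce e⇝w) with _ ∈? K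
    ... | yes c∈K = cross (reach-snoc u⇝v vc c∈K) c∈A ce e⇝w
    ... | no c∉K  =
      let bridge = bridged c∈A c∉K (Adj-sym vc) ce (A⊆B v∈A) (A⊆B (reach-source e⇝w))
      in continue (reach-trans u⇝v bridge) e⇝w

  -- the two ends of the cycle are the only neighbours of y
  through⇒bridged : deg S y ≤ 2 → T ⊆ S → T - y ⊆ K → CycleThrough T y → Bridged S K y
  through⇒bridged {S} {y} {K = K} d≤2 T⊆S T-y⊆K (_ , a , b , a≢b , ya , yb , a⇝b) yc yd c∈S d∈S =
    join (ends yc c∈S) (ends yd d∈S)
    where
    ends : Adj y z → z ∈ S → z ≡ a ⊎ z ≡ b
    ends = deg≤2⇒neighbour∈ d≤2 a≢b ya yb
      (T⊆S (p-x⊆p (reach-source a⇝b))) (T⊆S (p-x⊆p (reach-target a⇝b)))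
    a⇝b′ = reach-mono T-y⊆K a⇝b
    join : ∀ {c d} → c ≡ a ⊎ c ≡ b → d ≡ a ⊎ d ≡ b → Reach K c d
    join (inj₁ refl) (inj₁ refl) = here (reach-source a⇝b′)
    join (inj₁ refl) (inj₂ refl) = a⇝b′
    join (inj₂ refl) (inj₁ refl) = reach-sym a⇝b′
    join (inj₂ refl) (inj₂ refl) = here (reach-target a⇝b′)

  -- If y cannot be spared in G[S] - x, the cycles it leaves behind run through y alone,
  -- so a cycle through y supplies the bridge.
  essential⇒bridged : deg S y ≤ 2 → Forest (S ─ Y) → ¬ Forest ((S - x) ─ (Y - y)) →
                      Bridged S ((S ─ Y) - x) y
  essential⇒bridged {S} {y} {Y} {x} d≤2 forest ¬forest′ =
    through⇒bridged d≤2 (λ z∈ → p-x⊆p (p─q⊆p _ _ z∈)) shrink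
      (forest-deleted⇒through (forest-anti (p-x⊆p ∘ shrink) forest) (¬forest⇒cycle ¬forest′ .proj₂))
    where
    shrink : ((S - x) ─ (Y - y)) - y ⊆ (S ─ Y) - x
    shrink z∈ =
      let z∈S-x─Y-y , z≢y = x∈p-y⁻ z∈
          z∈S-x , z∉Y-y   = x∈p─q⁻ z∈S-x─Y-y
          z∈S , z≢x       = x∈p-y⁻ z∈S-x
      in x∈p∧x≢y⇒x∈p-y (x∈p∧x∉q⇒x∈p─q z∈S λ z∈Y → z∉Y-y (x∈p∧x≢y⇒x∈p-y z∈Y z≢y)) z≢x

  -- If x ∉ Y and no y ∈ Y can be spared in G[S] - x, every vertex of Y is bridged, and
  -- walking around the cycle through x yields a cycle through x that avoids Y.
  exchange : (∀ u → u ∈ S → u ∉ F → deg S u ≤ 2) → CycleThrough S x →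
             FeedbackSet S F Y → ∃ λ Y′ → FeedbackSet (S - x) F Y′ × ∣ Y′ ∣ < ∣ Y ∣
  exchange {S} {F} {x} {Y} deg≤2 (x∈S , p , q , p≢q , xp , xq , p⇝q) (Y∩F≡∅ , forest) with x ∈? Y
  ... | yes x∈Y = Y - x , (Y∩F≡∅ ∘ p-x⊆p , forest-anti p-x─q-x⊆p─q forest) , x∈p⇒∣p-x∣<∣p∣ x∈Y
  ... | no x∉Y with any? (λ y → y ∈? Y ×-dec forest? ((S - x) ─ (Y - y)))
  ...   | yes (y , y∈Y , forest′) = Y - y , (Y∩F≡∅ ∘ p-x⊆p , forest′) , x∈p⇒∣p-x∣<∣p∣ y∈Y
  ...   | no none = ⊥-elim (through⇒¬forest
            (x∈p∧x∉q⇒x∈p─q x∈S x∉Y , p , q , p≢q , xp , xq ,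
             reach-through-bridges p-x⊆p bridged p⇝q
               (attached (reach-source p⇝q) xp) (attached (reach-target p⇝q) xq))
            forest)
    where
    bridged : y ∈ S - x → y ∉ (S ─ Y) - x → Bridged S ((S ─ Y) - x) y
    bridged {y} y∈S-x y∉ =
      let y∈S , y≢x = x∈p-y⁻ y∈S-x
          y∈Y = decidable-stable (y ∈? Y) λ y∉Y → y∉ (x∈p∧x≢y⇒x∈p-y (x∈p∧x∉q⇒x∈p─q y∈S y∉Y) y≢x)
      in essential⇒bridged (deg≤2 y y∈S (Y∩F≡∅ y∈Y)) forest λ forest′ → none (y , y∈Y , forest′)

    -- otherwise y is bridged, which puts its neighbour x into (S ─ Y) - x
    attached : y ∈ S - x → Adj x y → y ∈ (S ─ Y) - x
    attached {y} y∈S-x xy with y ∈? (S ─ Y) - x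
    ... | yes y∈ = y∈
    ... | no y∉  =
      ⊥-elim (x∈p-y⁻ (reach-source (bridged y∈S-x y∉ (Adj-sym xy) (Adj-sym xy) x∈S x∈S)) .proj₂ refl)

  loop-⊆ : Loop F S X X′ → X ⊆ X′
  loop-⊆ (done _)       x∈X = x∈X
  loop-⊆ (next _ _ _ L) x∈X = loop-⊆ L (x∈p∪q⁺ (inj₁ x∈X))

  loop-forest : Loop F S X X′ → Forest (S ─ X′)
  loop-forest {S = S} (done forest) = forest-anti (p─q⊆p S _) forest
  loop-forest {S = S} {X′ = X′} (next {x = x} _ _ _ L) = forest-anti S─X′⊆ (loop-forest L)
    where
    S─X′⊆ : S ─ X′ ⊆ (S - x) ─ X′
    S─X′⊆ z∈ with x∈p─q⁻ z∈
    ... | z∈S , z∉X′ = x∈p∧x∉q⇒x∈p─q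
      (x∈p∧x≢y⇒x∈p-y z∈S λ { refl → z∉X′ (loop-⊆ L (x∈p∪q⁺ (inj₂ (x∈⁅x⁆ x)))) }) z∉X′

  loop-size : Loop F S X X′ → (∀ u → u ∈ S → u ∉ F → deg S u ≤ 2) →
              FeedbackSet S F Y → ∣ X′ ∣ ≤ ∣ X ∣ + ∣ Y ∣
  loop-size {X = X} (done _) _ _ = ℕₚ.m≤m+n ∣ X ∣ _
  loop-size {F = F} {S = S} {X = X} {X′ = X′} {Y = Y} (next {x = x} C x∈C _ L) deg≤2 fvs
    with exchange deg≤2 (cycle⇒through C x∈C) fvs
  ... | Y′ , fvs′ , ∣Y′∣<∣Y∣ = begin
    ∣ X′ ∣                  ≤⟨ loop-size L deg≤2′ fvs′ ⟩
    ∣ X ∪ ⁅ x ⁆ ∣ + ∣ Y′ ∣  ≤⟨ ℕₚ.+-monoˡ-≤ ∣ Y′ ∣ (∣p∪⁅x⁆∣≤1+∣p∣ X x) ⟩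
    suc (∣ X ∣ + ∣ Y′ ∣)    ≡⟨ sym (ℕₚ.+-suc ∣ X ∣ ∣ Y′ ∣) ⟩
    ∣ X ∣ + suc (∣ Y′ ∣)    ≤⟨ ℕₚ.+-monoʳ-≤ ∣ X ∣ ∣Y′∣<∣Y∣ ⟩
    ∣ X ∣ + ∣ Y ∣           ∎
    where
    open ℕₚ.≤-Reasoning
    deg≤2′ : ∀ u → u ∈ S - x → u ∉ F → deg (S - x) u ≤ 2
    deg≤2′ u u∈ u∉F = ℕₚ.≤-trans (deg-mono p-x⊆p) (deg≤2 u (p-x⊆p u∈) u∉F)

  -- Soundness

  Solution : Subset n → ℤ → Subset n → Subset n → Set
  Solution S k F Y = FeedbackSet S F Y × + ∣ Y ∣ ℤ.≤ k

  Correct : Subset n → ℤ → Subset n → Maybe (Subset n) → Set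
  Correct S k F (just X) = + ∣ X ∣ ℤ.≤ k × Forest (S ─ X)
  Correct S k F nothing  = ∀ Y → ¬ Solution S k F Y

  solution-drop : v ∈ Y → Solution S k F Y → Solution (S - v) (k ℤ.- + 1) F (Y - v)
  solution-drop v∈Y ((Y∩F≡∅ , forest) , ∣Y∣≤k) =
    (Y∩F≡∅ ∘ p-x⊆p , forest-anti p-x─q-x⊆p─q forest) ,
    1+m≤k⇒m≤k-1 (ℤₚ.≤-trans (+≤+ (x∈p⇒∣p-x∣<∣p∣ v∈Y)) ∣Y∣≤k)

  correct-step1 : deg S v < 2 → Correct (S - v) k (F - v) r → Correct S k F r
  correct-step1 {S} {v} {r = just X} low (∣X∣≤k , forest) =
    ∣X∣≤k , low-degree-forest (ℕₚ.≤-<-trans (deg-mono (p─q⊆p S X)) low) (forest-anti swap forest)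
    where
    swap : (S ─ X) - v ⊆ (S - v) ─ X
    swap z∈ = let z∈S─X , z≢v = x∈p-y⁻ z∈ ; z∈S , z∉X = x∈p─q⁻ z∈S─X in
      x∈p∧x∉q⇒x∈p─q (x∈p∧x≢y⇒x∈p-y z∈S z≢v) z∉X
  correct-step1 {r = nothing} _ none Y ((Y∩F≡∅ , forest) , ∣Y∣≤k) =
    none Y (((λ y∈ y∈F-v → Y∩F≡∅ y∈ (p-x⊆p y∈F-v)) , forest-anti (─-mono p-x⊆p id) forest) , ∣Y∣≤k)

  correct-add : Correct (S - v) (k ℤ.- + 1) F (just X) → Correct S k F (just (X ∪ ⁅ v ⁆))
  correct-add {S} {v} {X = X} (∣X∣≤k-1 , forest) =
    ℤₚ.≤-trans (+≤+ (∣p∪⁅x⁆∣≤1+∣p∣ X v)) (m≤k-1⇒1+m≤k ∣X∣≤k-1) , forest-anti shift forest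
    where
    shift : S ─ (X ∪ ⁅ v ⁆) ⊆ (S - v) ─ X
    shift z∈ with x∈p─q⁻ z∈
    ... | z∈S , z∉X∪v = x∈p∧x∉q⇒x∈p─q
      (x∈p∧x≢y⇒x∈p-y z∈S λ { refl → z∉X∪v (x∈p∪q⁺ (inj₂ (x∈⁅x⁆ v))) })
      (λ z∈X → z∉X∪v (x∈p∪q⁺ (inj₁ z∈X)))

  step2⇒through : F ⊆ S → (∀ {x} → x ∈ Y → x ∉ F) → v ∉ Y → Step2 S F v → CycleThrough (S ─ Y) v
  step2⇒through {F} {S} {Y} {v} F⊆S Y∩F≡∅ v∉Y (v∈S , v∉F , u , w , u≢w , vu , vw , _ , _ , u⇝w) =
    x∈p∧x∉q⇒x∈p─q v∈S v∉Y , u , w , u≢w , vu , vw , reach-mono F⊆ u⇝w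
    where
    F⊆ : F ⊆ (S ─ Y) - v
    F⊆ z∈F = x∈p∧x≢y⇒x∈p-y (x∈p∧x∉q⇒x∈p─q (F⊆S z∈F) λ z∈Y → Y∩F≡∅ z∈Y z∈F) λ { refl → v∉F z∈F }

  correct-step2-no : F ⊆ S → Step2 S F v →
                     Correct (S - v) (k ℤ.- + 1) F nothing → Correct S k F nothing
  correct-step2-no {v = v} F⊆S s2 none Y sol@((Y∩F≡∅ , forest) , _) with v ∈? Y
  ... | yes v∈Y = none (Y - v) (solution-drop v∈Y sol)
  ... | no v∉Y  = through⇒¬forest (step2⇒through F⊆S Y∩F≡∅ v∉Y s2) forest

  correct-step6 : Correct (S - v) (k ℤ.- + 1) F nothing → Correct S k (F ∪ ⁅ v ⁆) r →
                  Correct S k F r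
  correct-step6 {r = just _} _ answer = answer
  correct-step6 {v = v} {F = F} {r = nothing} none₋ none₊ Y sol@((Y∩F≡∅ , forest) , ∣Y∣≤k)
    with v ∈? Y
  ... | yes v∈Y = none₋ (Y - v) (solution-drop v∈Y sol)
  ... | no v∉Y  = none₊ Y ((Y∩F∪v≡∅ , forest) , ∣Y∣≤k)
    where
    Y∩F∪v≡∅ : y ∈ Y → y ∉ F ∪ ⁅ v ⁆
    Y∩F∪v≡∅ y∈Y y∈ with x∈p∪⁅y⁆⁻ F y∈
    ... | inj₁ y∈F = Y∩F≡∅ y∈Y y∈F
    ... | inj₂ refl = v∉Y y∈Y

  sound : F ⊆ S → Run S k F r → Correct S k F r
  sound _ (step0-neg k<0) Y (_ , ∣Y∣≤k) = ℤₚ.<⇒≱ k<0 (ℤₚ.≤-trans (+≤+ z≤n) ∣Y∣≤k)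
  sound {S = S} {k} _ (step0-empty 0≤k ∅) =
    subst (λ m → + m ℤ.≤ k) (sym (∣⊥∣≡0 n)) 0≤k , forest-anti (p─q⊆p S ⊥) (empty⇒forest ∅)
  sound F⊆S (step1 v _ _ _ low R) =
    correct-step1 low (sound (─-mono F⊆S id) R)
  sound F⊆S (step2-no v _ _ _ s2 R) =
    correct-step2-no F⊆S s2 (sound (p⊆q⇒p⊆q-x F⊆S (s2 .proj₂ .proj₁)) R)
  sound {F} F⊆S (step2-yes v _ _ _ s2 R) =
    correct-add {F = F} (sound (p⊆q⇒p⊆q-x F⊆S (s2 .proj₂ .proj₁)) R)
  sound _ (step4-yes _ _ _ _ _ _ _ L ∣X∣≤k) = ∣X∣≤k , loop-forest L
  sound {F} {S} _ (step4-no {X = X} _ _ _ _ _ (_ , _ , max) d≡2 L ∣X∣≰k) Y (fvs , ∣Y∣≤k) =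
    ∣X∣≰k (ℤₚ.≤-trans (+≤+ (subst (λ m → ∣ X ∣ ≤ m + ∣ Y ∣) (∣⊥∣≡0 n) (loop-size L deg≤2 fvs)))
                      ∣Y∣≤k)
    where
    deg≤2 : ∀ u → u ∈ S → u ∉ F → deg S u ≤ 2
    deg≤2 u u∈S u∉F = subst (deg S u ≤_) d≡2 (max u u∈S u∉F)
  sound {F} F⊆S (step5 v _ _ _ _ md _ R) =
    correct-add {F = F} (sound (p⊆q⇒p⊆q-x F⊆S (md .proj₂ .proj₁)) R)
  sound F⊆S (step6 v _ _ _ _ (v∈S , v∉F , _) _ R₋ R₊) =
    correct-step6 (sound (p⊆q⇒p⊆q-x F⊆S v∉F) R₋) (sound (p⊆q⇒p∪⁅x⁆⊆q F⊆S v∈S) R₊)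

  -- Existence of runs

  forest-extend : Forest F → v ∈ S → v ∉ F → ¬ Step2 S F v → Forest (F ∪ ⁅ v ⁆)
  forest-extend forest v∈S v∉F ¬s2 cs C with forest-deleted⇒through (forest-anti p∪⁅x⁆-x⊆p forest) C
  ... | _ , u , w , u≢w , vu , vw , u⇝w = ¬s2 (v∈S , v∉F , u , w , u≢w , vu , vw ,
          p∪⁅x⁆-x⊆p (reach-source u⇝w) , p∪⁅x⁆-x⊆p (reach-target u⇝w) , reach-mono p∪⁅x⁆-x⊆p u⇝w)

  free-vertex : Forest F → NoLowDeg S → Nonempty S → ∃ λ v → v ∈ S ─ F
  free-vertex forest δ (_ , v∈S) with through⇒cycle (mindeg⇒through δ v∈S .proj₂)
  ... | cs , C with cycle-leaves-forest forest C
  ...   | x , x∈cs , x∉F = x , x∈p∧x∉q⇒x∈p─q (All.lookup (cycle-vertices C) x∈cs) x∉F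

  max-degree : v ∈ S ─ F → ∃ (MaxDeg S F)
  max-degree {v} {S} {F} v∈ = v* , x∈p─q⁻ v*∈ .proj₁ , x∈p─q⁻ v*∈ .proj₂ , maximal
    where
    free = filter (_∈? S ─ F) (allFin n)
    v* = argmax (deg S) v free
    v*∈ : v* ∈ S ─ F
    v*∈ = argmax-all (deg S) v∈ (Allₚ.all-filter (_∈? S ─ F) (allFin n))
    maximal : ∀ u → u ∈ S → u ∉ F → deg S u ≤ deg S v*
    maximal u u∈S u∉F = All.lookup (f[xs]≤f[argmax] v free)
      (∈-filter⁺ (_∈? S ─ F) (∈-allFin u) (x∈p∧x∉q⇒x∈p─q u∈S u∉F))

  loop-exists : Forest F → ∀ S X → ∃ (Loop F S X)
  loop-exists {F} forest S X = go (suc ∣ S ∣) S X (ℕₚ.n<1+n _)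
    where
    go : ∀ t S X → ∣ S ∣ < t → ∃ (Loop F S X)
    go zero _ _ ()
    go (suc t) S X (s≤s ∣S∣≤t) with forest-or-cycle S
    ... | inj₁ forest-S = X , done forest-S
    ... | inj₂ (cs , C) with cycle-leaves-forest forest C
    ...   | x , x∈cs , x∉F
      with go t (S - x) (X ∪ ⁅ x ⁆)
              (ℕₚ.<-≤-trans (x∈p⇒∣p-x∣<∣p∣ (All.lookup (cycle-vertices C) x∈cs)) ∣S∣≤t)
    ...     | X′ , L = X′ , next C x∈cs x∉F L

  weight : Subset n → Subset n → ℕ
  weight S F = ∣ S ∣ + ∣ S ─ F ∣

  weight-delete : ∀ {F′} → v ∈ S → (S - v) ─ F′ ⊆ S ─ F → weight (S - v) F′ < weight S F
  weight-delete v∈S ⊆ = ℕₚ.+-mono-<-≤ (x∈p⇒∣p-x∣<∣p∣ v∈S) (p⊆q⇒∣p∣≤∣q∣ ⊆)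

  weight-extend : v ∈ S → v ∉ F → weight S (F ∪ ⁅ v ⁆) < weight S F
  weight-extend {v} {S} {F} v∈S v∉F = ℕₚ.+-monoʳ-< ∣ S ∣ (p⊂q⇒∣p∣<∣q∣ shrinks)
    where
    shrinks : S ─ (F ∪ ⁅ v ⁆) ⊂ S ─ F
    shrinks = ─-mono id (λ z∈ → x∈p∪q⁺ (inj₁ z∈)) , v , x∈p∧x∉q⇒x∈p─q v∈S v∉F ,
              λ v∈ → x∈p─q⇒x∉q S _ v∈ (x∈p∪q⁺ (inj₂ (x∈⁅x⁆ v)))

  Runs : ℕ → Set
  Runs t = ∀ S k F → F ⊆ S → Forest F → weight S F < t → ∃ (Run S k F)

  run-delete : ∀ {t} k → Runs t → weight S F ≤ t → F ⊆ S → Forest F → v ∈ S → v ∉ F →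
               ∃ (Run (S - v) k F)
  run-delete k rec w≤t F⊆S forest v∈S v∉F = rec _ k _ (p⊆q⇒p⊆q-x F⊆S v∉F) forest
    (ℕₚ.<-≤-trans (weight-delete v∈S (─-mono p-x⊆p id)) w≤t)

  run-step2 : ∀ {t m} → Runs t → weight S F ≤ t → F ⊆ S → Forest F → Nonempty S → NoLowDeg S →
              Step2 S F v → ∃ (Run S (+ m) F)
  run-step2 {v = v} {m = m} rec w≤t F⊆S forest ne δ s2@(v∈S , v∉F , _)
    with run-delete (+ m ℤ.- + 1) rec w≤t F⊆S forest v∈S v∉F
  ... | nothing , R = nothing , step2-no v (+≤+ z≤n) ne δ s2 R
  ... | just X , R  = just (X ∪ ⁅ v ⁆) , step2-yes v (+≤+ z≤n) ne δ s2 R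

  run-max-degree : ∀ {t m} → Runs t → weight S F ≤ t → F ⊆ S → Forest F → Nonempty S → NoLowDeg S →
                   (∀ u → ¬ Step2 S F u) → MaxDeg S F v → ∃ (Run S (+ m) F)
  run-max-degree {S} {F} {v} {m = m} rec w≤t F⊆S forest ne δ ¬s2 md@(v∈S , v∉F , _)
    with deg S v ℕ.≟ 2
  ... | yes d≡2 with loop-exists forest S ⊥
  ...   | X , L with + ∣ X ∣ ℤₚ.≤? + m
  ...     | yes ∣X∣≤m = just X , step4-yes v (+≤+ z≤n) ne δ ¬s2 md d≡2 L ∣X∣≤m
  ...     | no ∣X∣≰m  = nothing , step4-no v (+≤+ z≤n) ne δ ¬s2 md d≡2 L ∣X∣≰m
  run-max-degree {S} {F} {v} {m = m} rec w≤t F⊆S forest ne δ ¬s2 md@(v∈S , v∉F , _) | no d≢2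
    with run-delete (+ m ℤ.- + 1) rec w≤t F⊆S forest v∈S v∉F
  ... | just X , R = just (X ∪ ⁅ v ⁆) , step5 v (+≤+ z≤n) ne δ ¬s2 md d≢2 R
  ... | nothing , R₋ =
    map₂ (step6 v (+≤+ z≤n) ne δ ¬s2 md d≢2 R₋)
      (rec S (+ m) (F ∪ ⁅ v ⁆) (p⊆q⇒p∪⁅x⁆⊆q F⊆S v∈S) (forest-extend forest v∈S v∉F (¬s2 v))
           (ℕₚ.<-≤-trans (weight-extend v∈S v∉F) w≤t))

  run-exists : ∀ t → Runs t
  run-exists zero _ _ _ _ _ ()
  run-exists (suc t) S -[1+ _ ] F _ _ _ = nothing , step0-neg -<+
  run-exists (suc t) S (+ m) F F⊆S forest (s≤s w≤t) with nonempty? S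
  ... | no ∅ = just ⊥ , step0-empty (+≤+ z≤n) ∅
  ... | yes ne with any? (λ v → v ∈? S ×-dec deg S v ℕ.<? 2)
  ...   | yes (v , v∈S , low) =
    map₂ (step1 v (+≤+ z≤n) ne v∈S low)
      (run-exists t (S - v) (+ m) (F - v) (─-mono F⊆S id) (forest-anti p-x⊆p forest)
        (ℕₚ.<-≤-trans (weight-delete v∈S p-x─q-x⊆p─q) w≤t))
  ...   | no none with step2? S F
  ...     | yes (_ , s2) = run-step2 (run-exists t) w≤t F⊆S forest ne (no-low-degree none) s2
  ...     | no ¬s2 =
    let δ = no-low-degree none in
    run-max-degree (run-exists t) w≤t F⊆S forest ne δ (λ u s2 → ¬s2 (u , s2))
      (max-degree (free-vertex forest δ ne .proj₂) .proj₂)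

  correct⇒solves : ∀ {k} → Correct ⊤ (+ k) ⊥ r → Solves k r
  correct⇒solves {r = just X} (+≤+ ∣X∣≤k , forest) =
    ∣X∣≤k , forest-anti (λ x∈ → x∈p∧x∉q⇒x∈p─q ∈⊤ (x∈∁p⇒x∉p x∈)) forest
  correct⇒solves {r = nothing} none (Y , ∣Y∣≤k , forest) =
    none Y (((λ _ → ∉⊥) , forest-anti (λ x∈ → x∉p⇒x∈∁p (x∈p─q⇒x∉q ⊤ Y x∈)) forest) , +≤+ ∣Y∣≤k)

lemma1 : (n : ℕ) (adj : Fin n → Fin n → Bool) →
         (∀ u v → adj u v ≡ adj v u) → (∀ v → adj v v ≡ false) →
         (k : ℕ) →
         Σ (Maybe (Subset n)) (λ r → FVS.Run adj ⊤ (+ k) ⊥ r)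
         × (∀ r → FVS.Run adj ⊤ (+ k) ⊥ r → FVS.Solves adj k r)
lemma1 n adj adj-sym adj-irrefl k =
  run-exists _ ⊤ (+ k) ⊥ (λ _ → ∈⊤) (empty⇒forest λ (_ , x∈⊥) → ∉⊥ x∈⊥) (ℕₚ.n<1+n _) ,
  λ r R → correct⇒solves (sound (λ _ → ∈⊤) R)
  where open NaiveFVS adj adj-sym adj-irrefl
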